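{- Let $\mathbb{F}$ be a field, let $U \in \mathbb{F}^{n\times m}$ with $n \le m$ have full row rank $n$, and let $\Omega \subsetneq [n]$. Let $S\subseteq[m]$ be a maximal $\Omega$-valid set and let $C\subseteq S$ satisfy $\mathrm{rank}(U_{:,C})=n-1$. Then $S=E(C)$.
   Context: For $S\subseteq[m]$, $U_{:,S}$ denotes the submatrix of $U$ with columns indexed by $S$. For $\lambda\in\mathbb{F}^n$, $\mathrm{supp}(\lambda)=\{i:\lambda_i\neq 0\}$. A set $S\subseteq[m]$ is $\Omega$-valid if there exists $\lambda\in\mathbb{F}^n$ with $\mathrm{supp}(\lambda)\not\subseteq\Omega$ and $\lambda^T U_{:,S}=0$. An $\Omega$-valid set is maximal if it is not a proper subset of any other $\Omega$-valid set. The extension $E(C)$ of $C\subseteq[m]$ is the largest set $E\subseteq[m]$ such that the column span of $U_{:,C}$ equals the column span of $U_{:,E}$. -}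

module Defs where

open import Level using (Level; _⊔_; suc)
open import Algebra.Bundles using (CommutativeRing)
open import Data.Nat using (ℕ; _≤_)
open import Relation.Binary.PropositionalEquality using (_≡_)
open import Data.Fin using (Fin)
open import Data.Fin.Subset using (Subset; _∈_; _∉_; _⊆_; ∣_∣)
open import Data.Product using (Σ; ∃; _×_)
open import Relation.Nullary using (¬_)

record Field (c ℓ : Level) : Set (Level.suc (c ⊔ ℓ)) where
  field
    commutativeRing : CommutativeRing c ℓ
  open CommutativeRing commutativeRing public
  field
    0≉1     : ¬ (0# ≈ 1#)
    inverse : ∀ x → ¬ (x ≈ 0#) → ∃ λ y → (x * y) ≈ 1#

module LinAlg {c ℓ : Level} (F : Field c ℓ) where
  open Field F
  open import Algebra.Properties.Monoid.Sum +-monoid using (sum)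

  Matrix : ℕ → ℕ → Set c
  Matrix n m = Fin n → Fin m → Carrier

  Vec : ℕ → Set c
  Vec n = Fin n → Carrier

  SupportedIn : ∀ {m} → (Fin m → Carrier) → Subset m → Set ℓ
  SupportedIn {m} a T = ∀ (j : Fin m) → j ∉ T → a j ≈ 0#

  combo : ∀ {n m} → Matrix n m → (Fin m → Carrier) → Vec n
  combo U a i = sum (λ j → a j * U i j)

  InColSpan : ∀ {n m} → Matrix n m → Subset m → Vec n → Set (c ⊔ ℓ)
  InColSpan {n} U S v =
    ∃ λ a → SupportedIn a S × (∀ (i : Fin n) → v i ≈ combo U a i)

  SameColSpan : ∀ {n m} → Matrix n m → Subset m → Subset m → Set (c ⊔ ℓ)
  SameColSpan {n} U S T =
    ∀ (v : Vec n) → (InColSpan U S v → InColSpan U T v) × (InColSpan U T v → InColSpan U S v)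

  LinIndepCols : ∀ {n m} → Matrix n m → Subset m → Set (c ⊔ ℓ)
  LinIndepCols {n} {m} U T =
    ∀ a → SupportedIn a T → (∀ (i : Fin n) → combo U a i ≈ 0#) → ∀ (j : Fin m) → a j ≈ 0#

  HasRank : ∀ {n m} → Matrix n m → Subset m → ℕ → Set (c ⊔ ℓ)
  HasRank U C r =
    (∃ λ T → T ⊆ C × LinIndepCols U T × ∣ T ∣ ≡ r)
    × (∀ T → T ⊆ C → LinIndepCols U T → ∣ T ∣ ≤ r)

  Valid : ∀ {n m} → Matrix n m → Subset n → Subset m → Set (c ⊔ ℓ)
  Valid {n} {m} U Ω S =
    ∃ λ (lam : Vec n) →
      (∃ λ (i : Fin n) → ¬ (lam i ≈ 0#) × i ∉ Ω)
      × (∀ (j : Fin m) → j ∈ S → sum (λ i → lam i * U i j) ≈ 0#)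

  MaximalValid : ∀ {n m} → Matrix n m → Subset n → Subset m → Set (c ⊔ ℓ)
  MaximalValid U Ω S = Valid U Ω S × (∀ S' → Valid U Ω S' → S ⊆ S' → S' ⊆ S)

  IsExtension : ∀ {n m} → Matrix n m → Subset m → Subset m → Set (c ⊔ ℓ)
  IsExtension U C E = SameColSpan U C E × (∀ E' → SameColSpan U C E' → E' ⊆ E)

module Submission where

-- Let S be a maximal Ω-valid set, witnessed by λ with λ_{i₀} ≠ 0, and let
-- C ⊆ S contain n-1 independent columns T.  All columns of S lie in the
-- hyperplane λ^⊥ ⊆ F^n, on which deleting coordinate i₀ is injective; since
-- n columns in n-1 rows are always dependent, T ∪ {j} is dependent for each
-- column j ∈ S, which puts column j into span C.  Hence span S = span C, so
-- S ⊆ E(C) by maximality of E(C); conversely λ annihilates span C =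
-- span E(C), so E(C) is Ω-valid and E(C) ⊆ S by maximality of S.
--
-- F has no decidable equality, so choosing pivots and splitting on whether a
-- coefficient vanishes happen under a double negation, which is discharged at
-- the end because equality of subsets is decidable.

open import Defs
open import Level using (Level)
open import Data.Nat using (ℕ; _≤_; _∸_)
open import Data.Fin using (Fin)
open import Data.Fin.Subset using (Subset; _⊆_; _∉_; ⊤)
open import Data.Product using (∃)
open import Relation.Binary.PropositionalEquality using (_≡_)

open import Level using (_⊔_)
open import Data.Nat using (zero; suc; _<_; s≤s)
import Data.Nat.Properties as ℕ
open import Data.Fin using (punchIn; punchOut) renaming (zero to fz; suc to fs)
import Data.Fin.Properties as Fin
open import Data.Fin.Subset using (_∈_; _∪_; ⁅_⁆; _-_; ∣_∣; inside; outside; Nonempty)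
open import Data.Fin.Subset.Properties
  using (_∈?_; p─⊥≡p; p─q⊆p; x∈p∪q⁻; x∈p∪q⁺; x∈⁅x⁆; x∈⁅y⁆⇒x≡y;
         p⊆p∪q; p⊂q⇒∣p∣<∣q∣; ⊆-antisym)
open import Data.Vec using (_∷_; here; there)
open import Data.Vec.Properties using (≡-dec)
open import Data.Bool using () renaming (_≟_ to _≟ᴮ_)
open import Data.Product using (_,_; proj₁; proj₂; _×_)
import Data.Product as Product
open import Data.Sum using (_⊎_; inj₁; inj₂)
open import Data.Empty using (⊥; ⊥-elim)
open import Relation.Nullary using (¬_; Dec; yes; no; ¬?)
open import Relation.Nullary.Decidable using (_×-dec_; decidable-stable; ¬¬-excluded-middle)
open import Relation.Nullary.Negation using (¬¬-map; negated-stable)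
open import Relation.Binary.PropositionalEquality using (_≢_)
import Relation.Binary.PropositionalEquality as ≡
open import Function using (_∘_)

∣p∣≤1+∣p-x∣ : ∀ {m} (p : Subset m) (x : Fin m) → ∣ p ∣ ≤ suc ∣ p - x ∣
∣p∣≤1+∣p-x∣ (inside ∷ p) fz = ℕ.≤-reflexive (≡.cong (suc ∘ ∣_∣) (≡.sym (p─⊥≡p p)))
∣p∣≤1+∣p-x∣ (outside ∷ p) fz = ≡.subst (λ q → ∣ p ∣ ≤ suc ∣ q ∣) (≡.sym (p─⊥≡p p)) (ℕ.n≤1+n _)
∣p∣≤1+∣p-x∣ (inside ∷ p) (fs x) = s≤s (∣p∣≤1+∣p-x∣ p x)
∣p∣≤1+∣p-x∣ (outside ∷ p) (fs x) = ∣p∣≤1+∣p-x∣ p x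

x∉p-x : ∀ {m} (p : Subset m) (x : Fin m) → x ∉ p - x
x∉p-x (s ∷ p) fz ()
x∉p-x (s ∷ p) (fs x) (there x∈p-x) = x∉p-x p x x∈p-x

x∉p∪⁅y⁆ : ∀ {m} {p : Subset m} {x y : Fin m} → x ∉ p → x ≢ y → x ∉ p ∪ ⁅ y ⁆
x∉p∪⁅y⁆ {p = p} {y = y} x∉p x≢y x∈p∪⁅y⁆ with x∈p∪q⁻ p ⁅ y ⁆ x∈p∪⁅y⁆
... | inj₁ x∈p = x∉p x∈p
... | inj₂ x∈⁅y⁆ = x≢y (x∈⁅y⁆⇒x≡y y x∈⁅y⁆)

nonempty-if-positive : ∀ {m} (p : Subset m) → 0 < ∣ p ∣ → Nonempty p
nonempty-if-positive (inside ∷ p) _ = fz , here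
nonempty-if-positive (outside ∷ p) 0<∣p∣ = Product.map fs there (nonempty-if-positive p 0<∣p∣)

¬¬-bind : ∀ {a b} {A : Set a} {B : Set b} → ¬ ¬ A → (A → ¬ ¬ B) → ¬ ¬ B
¬¬-bind ¬¬a f = negated-stable (¬¬-map f ¬¬a)

¬¬-shift : ∀ {m a} {Q : Fin m → Set a} → (∀ j → ¬ ¬ Q j) → ¬ ¬ (∀ j → Q j)
¬¬-shift {zero} _ k = k (λ ())
¬¬-shift {suc m} {Q = Q} ¬¬Q k =
  ¬¬Q fz λ q₀ → ¬¬-shift {Q = Q ∘ fs} (¬¬Q ∘ fs) λ qₛ → k λ where
    fz → q₀
    (fs j) → qₛ j

¬¬-decide-all : ∀ {m a} (P : Fin m → Set a) → ¬ ¬ (∀ j → Dec (P j))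
¬¬-decide-all P = ¬¬-shift (λ j → ¬¬-excluded-middle)

¬¬-premise : ∀ {a b} {A : Set a} {B : Set b} → (A → ¬ ¬ B) → ¬ ¬ (A → B)
¬¬-premise f k = k (λ a → ⊥-elim (f a (λ b → k (λ _ → b))))

module LinearAlgebra {c ℓ : Level} (F : Field c ℓ) where
  open Field F hiding (_-_)
  open LinAlg F
  open import Algebra.Properties.Semiring.Sum semiring
    using (sum; sum-cong-≋; sum-replicate-zero; sum-remove; ∑-distrib-+; ∑-comm; *-distribˡ-sum; *-distribʳ-sum)
  open import Algebra.Properties.Ring ring using (-‿distribˡ-*)
  open import Relation.Binary.Reasoning.Setoid setoid

  sum-vanishes : ∀ {n} (f : Fin n → Carrier) → (∀ i → f i ≈ 0#) → sum f ≈ 0#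
  sum-vanishes {n} f f≈0 = trans (sum-cong-≋ f≈0) (sum-replicate-zero n)

  unit : ∀ {m} → Fin m → Fin m → Carrier
  unit j k with j Fin.≟ k
  ... | yes _ = 1#
  ... | no _ = 0#

  unit-diag : ∀ {m} (j : Fin m) → unit j j ≈ 1#
  unit-diag j with j Fin.≟ j
  ... | yes _ = refl
  ... | no j≢j = ⊥-elim (j≢j ≡.refl)

  unit-off : ∀ {m} {j k : Fin m} → j ≢ k → unit j k ≈ 0#
  unit-off {j = j} {k} j≢k with j Fin.≟ k
  ... | yes j≡k = ⊥-elim (j≢k j≡k)
  ... | no _ = refl

  sum-unit : ∀ {m} (j : Fin m) (g : Fin m → Carrier) → sum (λ k → unit j k * g k) ≈ g j
  sum-unit {suc m} j g = begin
    sum (λ k → unit j k * g k)                  ≈⟨ sum-remove {i = j} (λ k → unit j k * g k) ⟩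
    unit j j * g j + sum (λ k → unit j (punchIn j k) * g (punchIn j k))
      ≈⟨ +-cong (*-congʳ (unit-diag j)) (sum-vanishes _ off-diagonal) ⟩
    1# * g j + 0#                               ≈⟨ +-identityʳ _ ⟩
    1# * g j                                    ≈⟨ *-identityˡ _ ⟩
    g j                                         ∎
    where
    off-diagonal : ∀ k → unit j (punchIn j k) * g (punchIn j k) ≈ 0#
    off-diagonal k = trans (*-congʳ (unit-off (Fin.punchInᵢ≢i j k ∘ ≡.sym))) (zeroˡ _)

  sum-supported-vanishes : ∀ {m} (T : Subset m) (a X : Fin m → Carrier) →
    SupportedIn a T → (∀ k → k ∈ T → X k ≈ 0#) → sum (λ k → a k * X k) ≈ 0#
  sum-supported-vanishes T a X a∈T X≈0 = sum-vanishes _ (λ k → term k (k ∈? T))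
    where
    term : ∀ k → Dec (k ∈ T) → a k * X k ≈ 0#
    term k (yes k∈T) = trans (*-congˡ (X≈0 k k∈T)) (zeroʳ _)
    term k (no k∉T) = trans (*-congʳ (a∈T k k∉T)) (zeroˡ _)

  cancel-nonzero : ∀ x w → ¬ x ≈ 0# → x * w ≈ 0# → w ≈ 0#
  cancel-nonzero x w x≉0 xw≈0 with inverse x x≉0
  ... | y , xy≈1 = begin
    w             ≈⟨ sym (*-identityˡ w) ⟩
    1# * w        ≈⟨ *-congʳ (trans (sym xy≈1) (*-comm x y)) ⟩
    (y * x) * w   ≈⟨ *-assoc y x w ⟩
    y * (x * w)   ≈⟨ *-congˡ xw≈0 ⟩
    y * 0#        ≈⟨ zeroʳ y ⟩
    0#            ∎

  col : ∀ {n m} → Matrix n m → Fin m → Vec n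
  col U j i = U i j

  combo-linear : ∀ {n m} (U : Matrix n m) (f g : Fin m → Carrier) z i →
    combo U (λ k → f k + z * g k) i ≈ combo U f i + z * combo U g i
  combo-linear U f g z i = begin
    sum (λ k → (f k + z * g k) * U i k)
      ≈⟨ sum-cong-≋ (λ k → trans (distribʳ (U i k) (f k) (z * g k)) (+-congˡ (*-assoc z (g k) (U i k)))) ⟩
    sum (λ k → f k * U i k + z * (g k * U i k))
      ≈⟨ ∑-distrib-+ (λ k → f k * U i k) (λ k → z * (g k * U i k)) ⟩
    combo U f i + sum (λ k → z * (g k * U i k))
      ≈⟨ +-congˡ (sym (*-distribˡ-sum z (λ k → g k * U i k))) ⟩
    combo U f i + z * combo U g i ∎

  combo-shift : ∀ {n m} (U : Matrix n m) (b : Fin m → Carrier) z p i →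
    combo U (λ k → b k + z * unit p k) i ≈ combo U b i + z * U i p
  combo-shift U b z p i = trans (combo-linear U b (unit p) z i) (+-congˡ (*-congˡ (sum-unit p (U i))))

  swap-left : ∀ x y z → x * (y * z) ≈ y * (x * z)
  swap-left x y z = trans (sym (*-assoc x y z)) (trans (*-congʳ (*-comm x y)) (*-assoc y x z))

  pairing-combo : ∀ {n m} (U : Matrix n m) (lam : Vec n) (a : Fin m → Carrier) →
    sum (λ i → lam i * combo U a i) ≈ sum (λ k → a k * sum (λ i → lam i * U i k))
  pairing-combo U lam a = begin
    sum (λ i → lam i * combo U a i)
      ≈⟨ sum-cong-≋ (λ i → *-distribˡ-sum (lam i) (λ k → a k * U i k)) ⟩
    sum (λ i → sum (λ k → lam i * (a k * U i k)))  ≈⟨ ∑-comm (λ i k → lam i * (a k * U i k)) ⟩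
    sum (λ k → sum (λ i → lam i * (a k * U i k)))
      ≈⟨ sum-cong-≋ (λ k → sum-cong-≋ (λ i → swap-left (lam i) (a k) (U i k))) ⟩
    sum (λ k → sum (λ i → a k * (lam i * U i k)))
      ≈⟨ sum-cong-≋ (λ k → sym (*-distribˡ-sum (a k) (λ i → lam i * U i k))) ⟩
    sum (λ k → a k * sum (λ i → lam i * U i k)) ∎

  column-in-own-span : ∀ {n m} (U : Matrix n m) (C : Subset m) {j} → j ∈ C → InColSpan U C (col U j)
  column-in-own-span U C {j} j∈C =
    unit j , (λ k k∉C → unit-off (λ j≡k → k∉C (≡.subst (_∈ C) j≡k j∈C))) , (λ i → sym (sum-unit j (U i)))

  span-mono : ∀ {n m} (U : Matrix n m) {C S : Subset m} → C ⊆ S → ∀ v → InColSpan U C v → InColSpan U S v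
  span-mono U C⊆S v (a , a∈C , v≈Ua) = a , (λ k k∉S → a∈C k (k∉S ∘ C⊆S)) , v≈Ua

  annihilated-span : ∀ {n m} (U : Matrix n m) (lam : Vec n) (C : Subset m) →
    (∀ j → j ∈ C → sum (λ i → lam i * U i j) ≈ 0#) → ∀ v → InColSpan U C v → sum (λ i → lam i * v i) ≈ 0#
  annihilated-span U lam C lam⊥C v (a , a∈C , v≈Ua) = begin
    sum (λ i → lam i * v i)                       ≈⟨ sum-cong-≋ (λ i → *-congˡ (v≈Ua i)) ⟩
    sum (λ i → lam i * combo U a i)               ≈⟨ pairing-combo U lam a ⟩
    sum (λ k → a k * sum (λ i → lam i * U i k))   ≈⟨ sum-supported-vanishes C a _ a∈C lam⊥C ⟩
    0#                                            ∎

  span-absorb : ∀ {n m} (U : Matrix n m) (S C : Subset m) →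
    (∀ j → j ∈ S → InColSpan U C (col U j)) → ∀ v → InColSpan U S v → InColSpan U C v
  span-absorb {m = m} U S C inSpan v (a , a∈S , v≈Ua) = a′ , a′∈C , v≈Ua′
    where
    expr : ∀ j → Dec (j ∈ S) → Fin m → Carrier
    expr j (yes j∈S) = proj₁ (inSpan j j∈S)
    expr j (no _) = λ _ → 0#

    B : Fin m → Fin m → Carrier
    B j = expr j (j ∈? S)

    B∈C : ∀ j k → k ∉ C → (d : Dec (j ∈ S)) → expr j d k ≈ 0#
    B∈C j k k∉C (yes j∈S) = proj₁ (proj₂ (inSpan j j∈S)) k k∉C
    B∈C j k k∉C (no _) = refl

    outside-S : ∀ {j} → j ∉ S → ∀ x → a j * x ≈ 0#
    outside-S {j} j∉S x = trans (*-congʳ (a∈S j j∉S)) (zeroˡ x)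

    rewrite-column : ∀ i j → (d : Dec (j ∈ S)) → a j * U i j ≈ a j * combo U (expr j d) i
    rewrite-column i j (yes j∈S) = *-congˡ (proj₂ (proj₂ (inSpan j j∈S)) i)
    rewrite-column i j (no j∉S) = trans (outside-S j∉S (U i j)) (sym (outside-S j∉S _))

    a′ : Fin m → Carrier
    a′ k = sum (λ j → a j * B j k)

    a′∈C : SupportedIn a′ C
    a′∈C k k∉C = sum-vanishes _ (λ j → trans (*-congˡ (B∈C j k k∉C (j ∈? S))) (zeroʳ _))

    v≈Ua′ : ∀ i → v i ≈ combo U a′ i
    v≈Ua′ i = begin
      v i                                               ≈⟨ v≈Ua i ⟩
      sum (λ j → a j * U i j)                           ≈⟨ sum-cong-≋ (λ j → rewrite-column i j (j ∈? S)) ⟩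
      sum (λ j → a j * sum (λ k → B j k * U i k))
        ≈⟨ sum-cong-≋ (λ j → *-distribˡ-sum (a j) (λ k → B j k * U i k)) ⟩
      sum (λ j → sum (λ k → a j * (B j k * U i k)))
        ≈⟨ ∑-comm (λ j k → a j * (B j k * U i k)) ⟩
      sum (λ k → sum (λ j → a j * (B j k * U i k)))
        ≈⟨ sum-cong-≋ (λ k → sum-cong-≋ (λ j → sym (*-assoc (a j) (B j k) (U i k)))) ⟩
      sum (λ k → sum (λ j → (a j * B j k) * U i k))
        ≈⟨ sum-cong-≋ (λ k → sym (*-distribʳ-sum (U i k) (λ j → a j * B j k))) ⟩
      combo U a′ i ∎

  same-span : ∀ {n m} (U : Matrix n m) {C S : Subset m} → C ⊆ S →
    (∀ j → j ∈ S → InColSpan U C (col U j)) → SameColSpan U C S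
  same-span U {C} {S} C⊆S inSpan v = span-mono U C⊆S v , span-absorb U S C inSpan v

  Dependent : ∀ {d m} → Matrix d m → Subset m → Set (c ⊔ ℓ)
  Dependent {m = m} V T =
    ∃ λ (b : Fin m → Carrier) → SupportedIn b T × (∀ i → combo V b i ≈ 0#) × ∃ λ q → ¬ b q ≈ 0#

  dependent-without-rows : ∀ {m} (V : Matrix 0 m) (T : Subset m) → Nonempty T → Dependent V T
  dependent-without-rows V T (j , j∈T) =
    unit j , proj₁ (proj₂ (column-in-own-span V T j∈T)) , (λ ()) ,
    j , (λ e≈0 → 0≉1 (sym (trans (sym (unit-diag j)) e≈0)))

  drop-zero-row : ∀ {d m} (V : Matrix (suc d) m) (T : Subset m) →
    (∀ p → p ∈ T → V fz p ≈ 0#) → Dependent (V ∘ fs) T → Dependent V T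
  drop-zero-row V T row₀≈0 (b , b∈T , V′b≈0 , nonzero) = b , b∈T , Vb≈0 , nonzero
    where
    Vb≈0 : ∀ i → combo V b i ≈ 0#
    Vb≈0 fz = sum-supported-vanishes T b (V fz) b∈T row₀≈0
    Vb≈0 (fs i) = V′b≈0 i

  combo-add-column-multiple : ∀ {n m} (V : Matrix n m) (t b : Fin m → Carrier) p i →
    combo (λ i k → V i k + t k * V i p) b i ≈ combo V b i + sum (λ k → b k * t k) * V i p
  combo-add-column-multiple V t b p i = begin
    sum (λ k → b k * (V i k + t k * V i p))
      ≈⟨ sum-cong-≋ (λ k → trans (distribˡ (b k) _ _) (+-congˡ (sym (*-assoc (b k) (t k) (V i p))))) ⟩
    sum (λ k → b k * V i k + (b k * t k) * V i p)
      ≈⟨ ∑-distrib-+ (λ k → b k * V i k) (λ k → (b k * t k) * V i p) ⟩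
    combo V b i + sum (λ k → (b k * t k) * V i p)
      ≈⟨ +-congˡ (sym (*-distribʳ-sum (V i p) (λ k → b k * t k))) ⟩
    combo V b i + sum (λ k → b k * t k) * V i p ∎

  -- Gaussian elimination with pivot V₀ₚ (y its inverse): clear row 0 by
  -- adding -(y V₀ₖ) times column p to every column k, then delete row 0.
  pivot-reduce : ∀ {d m} → Matrix (suc d) m → Fin m → Carrier → Matrix d m
  pivot-reduce V p y i k = V (fs i) k + ((- y) * V fz k) * V (fs i) p

  pivot-cancels : ∀ s y r → r * y ≈ 1# → s + ((- y) * s) * r ≈ 0#
  pivot-cancels s y r ry≈1 = begin
    s + ((- y) * s) * r    ≈⟨ +-congˡ (trans (*-congʳ (sym (-‿distribˡ-* y s))) (sym (-‿distribˡ-* (y * s) r))) ⟩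
    s + - ((y * s) * r)    ≈⟨ +-congˡ (-‿cong ysr≈s) ⟩
    s + - s                ≈⟨ -‿inverseʳ s ⟩
    0#                     ∎
    where
    ysr≈s : (y * s) * r ≈ s
    ysr≈s = begin
      (y * s) * r   ≈⟨ *-congʳ (*-comm y s) ⟩
      (s * y) * r   ≈⟨ *-assoc s y r ⟩
      s * (y * r)   ≈⟨ *-congˡ (trans (*-comm y r) ry≈1) ⟩
      s * 1#        ≈⟨ *-identityʳ s ⟩
      s             ∎

  -- A dependency b of the reduced matrix on T - p lifts to the dependency
  -- b + z e_p of V on T, where z is chosen to clear row 0.
  eliminate-pivot : ∀ {d m} (V : Matrix (suc d) m) (T : Subset m) (p : Fin m) (y : Carrier) →
    p ∈ T → V fz p * y ≈ 1# → Dependent (pivot-reduce V p y) (T - p) → Dependent V T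
  eliminate-pivot {m = m} V T p y p∈T pivot (b , b∈T-p , Wb≈0 , q , bq≉0) = a , a∈T , Va≈0 , q , aq≉0
    where
    t : Fin m → Carrier
    t k = (- y) * V fz k
    z : Carrier
    z = sum (λ k → b k * t k)
    a : Fin m → Carrier
    a k = b k + z * unit p k

    z≈-ys : z ≈ (- y) * combo V b fz
    z≈-ys = trans (sum-cong-≋ (λ k → swap-left (b k) (- y) (V fz k))) (sym (*-distribˡ-sum (- y) (λ k → b k * V fz k)))

    a∈T : SupportedIn a T
    a∈T k k∉T = trans (+-cong (b∈T-p k (k∉T ∘ p─q⊆p T ⁅ p ⁆))
                              (trans (*-congˡ (unit-off (λ p≡k → k∉T (≡.subst (_∈ T) p≡k p∈T)))) (zeroʳ z)))
                      (+-identityˡ 0#)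

    q≢p : q ≢ p
    q≢p ≡.refl = bq≉0 (b∈T-p p (x∉p-x T p))

    aq≈bq : a q ≈ b q
    aq≈bq = trans (+-congˡ (trans (*-congˡ (unit-off (q≢p ∘ ≡.sym))) (zeroʳ z))) (+-identityʳ (b q))

    aq≉0 : ¬ a q ≈ 0#
    aq≉0 aq≈0 = bq≉0 (trans (sym aq≈bq) aq≈0)

    Va≈0 : ∀ i → combo V a i ≈ 0#
    Va≈0 fz = begin
      combo V a fz                       ≈⟨ combo-shift V b z p fz ⟩
      combo V b fz + z * V fz p          ≈⟨ +-congˡ (*-congʳ z≈-ys) ⟩
      combo V b fz + ((- y) * combo V b fz) * V fz p ≈⟨ pivot-cancels (combo V b fz) y (V fz p) pivot ⟩
      0#                                 ∎
    Va≈0 (fs i) = begin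
      combo V a (fs i)                   ≈⟨ combo-shift V b z p (fs i) ⟩
      combo V b (fs i) + z * V (fs i) p  ≈⟨ sym (combo-add-column-multiple (V ∘ fs) t b p i) ⟩
      combo (pivot-reduce V p y) b i     ≈⟨ Wb≈0 i ⟩
      0#                                 ∎

  ¬¬-vanishes-or-pivot : ∀ {m} (r : Fin m → Carrier) (T : Subset m) →
    ¬ ¬ ((∀ p → p ∈ T → r p ≈ 0#) ⊎ ∃ λ p → p ∈ T × ¬ r p ≈ 0#)
  ¬¬-vanishes-or-pivot r T = ¬¬-map decide (¬¬-decide-all (λ p → r p ≈ 0#))
    where
    decide : (∀ p → Dec (r p ≈ 0#)) → (∀ p → p ∈ T → r p ≈ 0#) ⊎ ∃ λ p → p ∈ T × ¬ r p ≈ 0#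
    decide r≟0 with Fin.any? (λ p → p ∈? T ×-dec ¬? (r≟0 p))
    ... | yes pivot = inj₂ pivot
    ... | no none = inj₁ (λ p p∈T → decidable-stable (r≟0 p) (λ rp≉0 → none (p , p∈T , rp≉0)))

  wide-matrix-dependent : ∀ d {m} (V : Matrix d m) (T : Subset m) → d < ∣ T ∣ → ¬ ¬ Dependent V T
  wide-matrix-dependent zero V T 0<∣T∣ k = k (dependent-without-rows V T (nonempty-if-positive T 0<∣T∣))
  wide-matrix-dependent (suc d) V T d+1<∣T∣ = ¬¬-bind (¬¬-vanishes-or-pivot (V fz) T) λ where
    (inj₁ row₀≈0) →
      ¬¬-map (drop-zero-row V T row₀≈0) (wide-matrix-dependent d (V ∘ fs) T (ℕ.<-trans (ℕ.n<1+n d) d+1<∣T∣))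
    (inj₂ (p , p∈T , Vp≉0)) → let (y , pivot) = inverse (V fz p) Vp≉0 in
      ¬¬-map (eliminate-pivot V T p y p∈T pivot)
             (wide-matrix-dependent d (pivot-reduce V p y) (T - p)
                (ℕ.≤-pred (ℕ.≤-trans d+1<∣T∣ (∣p∣≤1+∣p-x∣ T p))))

  orthogonal-vanishes : ∀ {n} (lam w : Vec (suc n)) (i₀ : Fin (suc n)) → ¬ lam i₀ ≈ 0# →
    sum (λ i → lam i * w i) ≈ 0# → (∀ i → w (punchIn i₀ i) ≈ 0#) → ∀ i → w i ≈ 0#
  orthogonal-vanishes lam w i₀ lam≉0 lam⊥w rest≈0 i with i₀ Fin.≟ i
  ... | yes ≡.refl = cancel-nonzero (lam i₀) (w i₀) lam≉0 (begin
    lam i₀ * w i₀                                              ≈⟨ sym (+-identityʳ _) ⟩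
    lam i₀ * w i₀ + 0#
      ≈⟨ +-congˡ (sym (sum-vanishes _ (λ k → trans (*-congˡ (rest≈0 k)) (zeroʳ _)))) ⟩
    lam i₀ * w i₀ + sum (λ k → lam (punchIn i₀ k) * w (punchIn i₀ k))
      ≈⟨ sym (sum-remove {i = i₀} (λ i → lam i * w i)) ⟩
    sum (λ i → lam i * w i)                                    ≈⟨ lam⊥w ⟩
    0#                                                         ∎)
  ... | no i₀≢i = ≡.subst (λ x → w x ≈ 0#) (Fin.punchIn-punchOut i₀≢i) (rest≈0 (punchOut i₀≢i))

  solve-for-column : ∀ {n m} (U : Matrix n m) (T : Subset m) (j : Fin m) (b : Fin m → Carrier) →
    SupportedIn b (T ∪ ⁅ j ⁆) → (∀ i → combo U b i ≈ 0#) → ¬ b j ≈ 0# → InColSpan U T (col U j)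
  solve-for-column {m = m} U T j b b∈T∪j Ub≈0 bj≉0 with inverse (b j) bj≉0
  ... | y , bjy≈1 = a , a∈T , Uj≈Ua
    where
    a : Fin m → Carrier
    a k = unit j k + (- y) * b k

    aj≈0 : a j ≈ 0#
    aj≈0 = begin
      unit j j + (- y) * b j  ≈⟨ +-cong (unit-diag j) (sym (-‿distribˡ-* y (b j))) ⟩
      1# + - (y * b j)        ≈⟨ +-congˡ (-‿cong (trans (*-comm y (b j)) bjy≈1)) ⟩
      1# + - 1#               ≈⟨ -‿inverseʳ 1# ⟩
      0#                      ∎

    a-off : ∀ k → k ∉ T → Dec (j ≡ k) → a k ≈ 0#
    a-off k k∉T (yes ≡.refl) = aj≈0
    a-off k k∉T (no j≢k) =
      trans (+-cong (unit-off j≢k) (trans (*-congˡ (b∈T∪j k (x∉p∪⁅y⁆ k∉T (j≢k ∘ ≡.sym)))) (zeroʳ _)))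
            (+-identityˡ 0#)

    a∈T : SupportedIn a T
    a∈T k k∉T = a-off k k∉T (j Fin.≟ k)

    Uj≈Ua : ∀ i → U i j ≈ combo U a i
    Uj≈Ua i = sym (begin
      combo U a i                          ≈⟨ combo-linear U (unit j) b (- y) i ⟩
      combo U (unit j) i + (- y) * combo U b i ≈⟨ +-cong (sum-unit j (U i)) (trans (*-congˡ (Ub≈0 i)) (zeroʳ _)) ⟩
      U i j + 0#                           ≈⟨ +-identityʳ _ ⟩
      U i j                                ∎)

  -- Let λ (with λ_{i₀} ≠ 0) annihilate the columns of S, and let T ⊆ C ⊆ S
  -- be n independent columns of the (n+1)-row matrix U.  Then every column
  -- of S lies (classically) in span C: otherwise T ∪ {j} would be n+1
  -- independent vectors in the n-dimensional space λ^⊥.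
  column-in-span : ∀ {n m} (U : Matrix (suc n) m) (lam : Vec (suc n)) (i₀ : Fin (suc n)) →
    ¬ lam i₀ ≈ 0# → (S C T : Subset m) → (∀ j → j ∈ S → sum (λ i → lam i * U i j) ≈ 0#) →
    T ⊆ C → C ⊆ S → LinIndepCols U T → ∣ T ∣ ≡ n → ∀ j → j ∈ S → ¬ ¬ InColSpan U C (col U j)
  column-in-span {n} {m} U lam i₀ lam≉0 S C T lam⊥S T⊆C C⊆S T-indep ∣T∣≡n j j∈S j∉span =
    wide-matrix-dependent n (λ i → U (punchIn i₀ i)) T′ n<∣T′∣ refute
    where
    T′ : Subset m
    T′ = T ∪ ⁅ j ⁆

    j∉T : j ∉ T
    j∉T j∈T = j∉span (column-in-own-span U C (T⊆C j∈T))

    n<∣T′∣ : n < ∣ T′ ∣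
    n<∣T′∣ = ≡.subst (_< ∣ T′ ∣) ∣T∣≡n (p⊂q⇒∣p∣<∣q∣ (p⊆p∪q ⁅ j ⁆ , j , x∈p∪q⁺ (inj₂ (x∈⁅x⁆ j)) , j∉T))

    T′⊆S : T′ ⊆ S
    T′⊆S k∈T′ with x∈p∪q⁻ T ⁅ j ⁆ k∈T′
    ... | inj₁ k∈T = C⊆S (T⊆C k∈T)
    ... | inj₂ k∈⁅j⁆ = ≡.subst (_∈ S) (≡.sym (x∈⁅y⁆⇒x≡y j k∈⁅j⁆)) j∈S

    refute : Dependent (λ i → U (punchIn i₀ i)) T′ → ⊥
    refute (b , b∈T′ , Vb≈0 , q , bq≉0) = ¬¬-excluded-middle by-cases
      where
      Ub≈0 : ∀ i → combo U b i ≈ 0#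
      Ub≈0 = orthogonal-vanishes lam (combo U b) i₀ lam≉0
               (annihilated-span U lam T′ (λ k k∈T′ → lam⊥S k (T′⊆S k∈T′)) (combo U b) (b , b∈T′ , λ i → refl))
               Vb≈0

      b∈T : b j ≈ 0# → SupportedIn b T
      b∈T bj≈0 k k∉T with k Fin.≟ j
      ... | yes ≡.refl = bj≈0
      ... | no k≢j = b∈T′ k (x∉p∪⁅y⁆ k∉T k≢j)

      by-cases : Dec (b j ≈ 0#) → ⊥
      by-cases (yes bj≈0) = bq≉0 (T-indep b (b∈T bj≈0) Ub≈0 q)
      by-cases (no bj≉0) = j∉span (span-mono U T⊆C (col U j) (solve-for-column U T j b b∈T′ Ub≈0 bj≉0))

  extension-valid : ∀ {n m} (U : Matrix n m) (Ω : Subset n) (lam : Vec n) →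
    (∃ λ i → ¬ lam i ≈ 0# × i ∉ Ω) → (C E : Subset m) →
    (∀ j → j ∈ C → sum (λ i → lam i * U i j) ≈ 0#) → SameColSpan U C E → Valid U Ω E
  extension-valid U Ω lam witness C E lam⊥C C~E =
    lam , witness , λ j j∈E →
      annihilated-span U lam C lam⊥C (col U j) (proj₂ (C~E (col U j)) (column-in-own-span U E j∈E))

mainTheorem11 : ∀ {c ℓ : Level} (F : Field c ℓ) → let open LinAlg F in
    ∀ (n m : ℕ) (U : Matrix n m) → n ≤ m → HasRank U ⊤ n →
    ∀ (Ω : Subset n) → ∃ (λ (i : Fin n) → i ∉ Ω) →
    ∀ (S : Subset m) → MaximalValid U Ω S →
    ∀ (C : Subset m) → C ⊆ S → HasRank U C (n ∸ 1) →
    ∀ (E : Subset m) → IsExtension U C E → S ≡ E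
mainTheorem11 F zero m U _ _ Ω (() , _)
mainTheorem11 F (suc n) m U _ _ Ω _ S ((lam , witness@(i₀ , lam≉0 , _) , lam⊥S) , S-maximal)
              C C⊆S ((T , T⊆C , T-indep , ∣T∣≡n) , _) E (C~E , E-largest) =
  decidable-stable (≡-dec _≟ᴮ_ S E) (¬¬-map S≡E (¬¬-shift columns-in-span))
  where
  open LinAlg F
  open LinearAlgebra F

  columns-in-span : ∀ j → ¬ ¬ (j ∈ S → InColSpan U C (col U j))
  columns-in-span j = ¬¬-premise (column-in-span U lam i₀ lam≉0 S C T lam⊥S T⊆C C⊆S T-indep ∣T∣≡n j)

  S≡E : (∀ j → j ∈ S → InColSpan U C (col U j)) → S ≡ E
  S≡E inSpan = ⊆-antisym S⊆E E⊆S
    where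
    S⊆E : S ⊆ E
    S⊆E = E-largest S (same-span U C⊆S inSpan)

    E⊆S : E ⊆ S
    E⊆S = S-maximal E (extension-valid U Ω lam witness C E (λ j → lam⊥S j ∘ C⊆S) C~E) S⊆E
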